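{- Let $P$ be a pcd-lattice and $\lhd$ a strong inclusion on $P$. Then $(\mathcal R(P),B_d)$, the class of round ideals of $(P,\lhd)$ ordered by inclusion with basis $B_d=\{\Downarrow a:a\in P\}$, is a compact regular locale.
   Context: Framework: constructive set theory CZF + RRS-$\bigcup$REA (intuitionistic logic, no Powerset, Restricted Separation only). A pcd-lattice is a partial order $(P,\le)$ with $P,\le$ sets that is a pseudocomplemented distributive lattice. A strong inclusion on $P$ is a set-relation $\lhd$ with: (1) $0\lhd0$, $1\lhd1$; (2) $x\le a\lhd b\le y\Rightarrow x\lhd y$; (3) $x\lhd a,x\lhd b\Rightarrow x\lhd a\wedge b$; (4) $x\lhd a,y\lhd a\Rightarrow x\vee y\lhd a$; (5) $a\lhd b\Rightarrow b^*\lhd a^*$; (6) $x\lhd y\Rightarrow x\vee y^*=1$; (7) $x\lhd y\Rightarrow x\lhd z\lhd y$ for some $z$. An ideal is a subset $I\subseteq P$ closed downward and under finite joins; it is round if for each $b\in I$ there is $a\in I$ with $b\lhd a$. $\Downarrow a=\{b\in P:b\lhd a\}$ is a round ideal. Finite meets of round ideals are intersections; the join of a set $\mathcal U$ of round ideals is $\{x\in P:\exists$ finite $u\subseteq\bigcup\mathcal U$ with $x\le\vee u\}$. A locale is a class-frame with a set basis $B$ (every element is the join of the set of basic elements below it); with $y^*=\bigvee\{c\in B:c\wedge y=0\}$ and $y\prec x$ iff $1=x\vee y^*$, it is regular if $a=\bigvee\{b\in B:b\prec a\}$ for $a\in B$, compact if every subset of $B$ with join $1$ has a finite subset with join $1$.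 -}

module Defs where

open import Data.Product using (Σ; _×_; _,_; proj₁; proj₂)
open import Data.Bool using (Bool; true; false)
open import Data.Unit using (⊤; tt)
open import Data.Empty using (⊥)
open import Data.List using (List; []; _∷_; foldr; map; length; lookup)
open import Data.Fin using (Fin)
open import Relation.Binary.PropositionalEquality using (_≡_)
open import Relation.Binary.Definitions using (Minimum; Maximum)
open import Relation.Binary.Lattice.Structures using (IsDistributiveLattice)

record PCDLattice : Set₁ where
  infixr 6 _∨_
  infixr 7 _∧_
  infix 4 _≤_
  field
    Carrier : Set
    _≤_     : Carrier → Carrier → Set
    _∨_     : Carrier → Carrier → Carrier
    _∧_     : Carrier → Carrier → Carrier
    𝟙       : Carrier
    𝟘       : Carrier
    _*      : Carrier → Carrier
    isDistributiveLattice : IsDistributiveLattice _≡_ _≤_ _∨_ _∧_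
    maximum : Maximum _≤_ 𝟙
    minimum : Minimum _≤_ 𝟘
    pseudo-intro : ∀ a x → x ∧ a ≡ 𝟘 → x ≤ a *
    pseudo-elim  : ∀ a x → x ≤ a * → x ∧ a ≡ 𝟘

  ⋁L : List Carrier → Carrier
  ⋁L = foldr _∨_ 𝟘

record StrongInclusion (L : PCDLattice) : Set₁ where
  open PCDLattice L
  infix 4 _◁_
  field
    _◁_   : Carrier → Carrier → Set
    si-0  : 𝟘 ◁ 𝟘
    si-1  : 𝟙 ◁ 𝟙
    si-mono : ∀ {x a b y} → x ≤ a → a ◁ b → b ≤ y → x ◁ y
    si-∧  : ∀ {x a b} → x ◁ a → x ◁ b → x ◁ a ∧ b
    si-∨  : ∀ {x y a} → x ◁ a → y ◁ a → x ∨ y ◁ a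
    si-*  : ∀ {a b} → a ◁ b → b * ◁ a *
    si-well : ∀ {x y} → x ◁ y → (x *) ∨ y ≡ 𝟙
    si-interp : ∀ {x y} → x ◁ y → Σ Carrier λ z → (x ◁ z) × (z ◁ y)

module RoundIdeals (L : PCDLattice) (S : StrongInclusion L) where
  open PCDLattice L
  open StrongInclusion S

  Subset : Set₁
  Subset = Carrier → Set

  infix 4 _⊆_ _≐_
  _⊆_ : Subset → Subset → Set
  A ⊆ B = ∀ x → A x → B x

  _≐_ : Subset → Subset → Set
  A ≐ B = (A ⊆ B) × (B ⊆ A)

  record IsRoundIdeal (I : Subset) : Set where
    field
      down  : ∀ {x y} → x ≤ y → I y → I x
      has-𝟘 : I 𝟘
      ∨-closed : ∀ {x y} → I x → I y → I (x ∨ y)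
      round : ∀ {b} → I b → Σ Carrier λ a → I a × (b ◁ a)

  ⇓ : Carrier → Subset
  ⇓ a b = b ◁ a

  ⊤ᵢ : Subset
  ⊤ᵢ _ = ⊤

  infixr 7 _∩_
  _∩_ : Subset → Subset → Subset
  (A ∩ B) x = A x × B x

  -- x ∈ ⋁ U  iff  x ≤ ⋁ u for a finite u ⊆ ⋃ U (u given as a list of
  -- elements of ⋃ U together with the witnesses of membership)
  ⋁ᵢ : {J : Set} → (J → Subset) → Subset
  ⋁ᵢ {J} U x = Σ (List (Σ J λ j → Σ Carrier λ y → U j y))
                 λ u → x ≤ ⋁L (map (λ e → proj₁ (proj₂ e)) u)

  ⊥ᵢ : Subset
  ⊥ᵢ = ⋁ᵢ {⊥} (λ ())

  infixr 6 _∨ᵢ_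
  _∨ᵢ_ : Subset → Subset → Subset
  A ∨ᵢ B = ⋁ᵢ {Bool} (λ { true → A ; false → B })

  _*ᵢ : Subset → Subset
  y *ᵢ = ⋁ᵢ {Σ Carrier λ c → (⇓ c ∩ y) ≐ ⊥ᵢ} (λ e → ⇓ (proj₁ e))

  infix 4 _≺_
  _≺_ : Subset → Subset → Set
  y ≺ x = ⊤ᵢ ≐ (x ∨ᵢ (y *ᵢ))

  record IsLocale : Set₁ where
    field
      ⊤-round : IsRoundIdeal ⊤ᵢ
      ⇓-round : ∀ a → IsRoundIdeal (⇓ a)
      ∩-round : ∀ {A B} → IsRoundIdeal A → IsRoundIdeal B → IsRoundIdeal (A ∩ B)
      ⋁-round : ∀ {J : Set} (U : J → Subset) → (∀ j → IsRoundIdeal (U j))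
                → IsRoundIdeal (⋁ᵢ U)
      ⋁-upper : ∀ {J : Set} (U : J → Subset) → (∀ j → IsRoundIdeal (U j))
                → ∀ j → U j ⊆ ⋁ᵢ U
      ⋁-least : ∀ {J : Set} (U : J → Subset) → (∀ j → IsRoundIdeal (U j))
                → ∀ V → IsRoundIdeal V → (∀ j → U j ⊆ V) → ⋁ᵢ U ⊆ V
      distrib : ∀ {J : Set} (A : Subset) (U : J → Subset) → IsRoundIdeal A
                → (∀ j → IsRoundIdeal (U j))
                → (A ∩ ⋁ᵢ U) ≐ ⋁ᵢ (λ j → A ∩ U j)
      basis   : ∀ A → IsRoundIdeal A
                → A ≐ ⋁ᵢ {Σ Carrier λ a → ⇓ a ⊆ A} (λ e → ⇓ (proj₁ e))

  IsRegular : Set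
  IsRegular = ∀ a → ⇓ a ≐ ⋁ᵢ {Σ Carrier λ b → ⇓ b ≺ ⇓ a} (λ e → ⇓ (proj₁ e))

  IsCompact : Set₁
  IsCompact = ∀ (J : Set) (f : J → Carrier) → ⊤ᵢ ≐ ⋁ᵢ (λ j → ⇓ (f j))
              → Σ (List J) λ js → ⊤ᵢ ≐ ⋁ᵢ {Fin (length js)} (λ i → ⇓ (f (lookup js i)))

  IsCompactRegularLocale : Set₁
  IsCompactRegularLocale = IsLocale × IsRegular × IsCompact

{-# OPTIONS --safe #-}
-- Interpolation makes ∩ and the finitary joins of round ideals round again, and a
-- round ideal is the union of the ⇓ a it contains.  Regularity: for b ◁ a, interpolating
-- b ◁ b₁ ◁ b₂ ◁ a gives 𝟙 = b₁ * ∨ b₂ with b₂ ∈ ⇓ a and b₁ * ◁ b *, while ⇓ (b *) is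
-- disjoint from ⇓ b; hence ⇓ b ≺ ⇓ a.  Conversely B ≺ A forces B ⊆ A, since every element
-- of B meets every element of B *ᵢ in 𝟘.  Compactness holds because membership of 𝟙 in
-- a join is witnessed by a finite list.
module Submission where

open import Defs
open import Data.Bool using (true; false)
open import Data.Fin using (zero; suc)
open import Data.List using (List; []; _∷_; map; lookup; _++_)
open import Data.List.Properties using (map-++; map-∘; foldr-preservesᵇ)
open import Data.List.Relation.Unary.All using (universal)
open import Data.List.Relation.Unary.All.Properties using (map⁺)
open import Data.Product using (Σ; _,_; proj₁; proj₂)
open import Data.Unit using (tt)
open import Function using (_∘_)
open import Level using (0ℓ)
open import Relation.Binary.Lattice.Bundles using (DistributiveLattice)
open import Relation.Binary.PropositionalEquality using (_≡_; refl; sym; trans; cong; subst)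
import Relation.Binary.Lattice.Properties.JoinSemilattice as JoinSemilatticeProperties
import Relation.Binary.Lattice.Properties.MeetSemilattice as MeetSemilatticeProperties
import Relation.Binary.Reasoning.PartialOrder as ≤-Reasoning

module PCDLatticeProperties (L : PCDLattice) where
  open PCDLattice L

  distributiveLattice : DistributiveLattice 0ℓ 0ℓ 0ℓ
  distributiveLattice = record { isDistributiveLattice = isDistributiveLattice }

  open DistributiveLattice distributiveLattice public
    using (poset; joinSemilattice; meetSemilattice
          ; x≤x∨y; y≤x∨y; x∧y≤x; x∧y≤y; ∨-least; ∧-greatest; ∧-distribˡ-∨)
    renaming (refl to ≤-refl; trans to ≤-trans; reflexive to ≤-reflexive)
  open JoinSemilatticeProperties joinSemilattice public using (∨-monotonic; ∨-comm; ∨-assoc)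
  open MeetSemilatticeProperties meetSemilattice public using (∧-monotonic; ∧-comm)
  open ≤-Reasoning poset

  *∧≡𝟘 : ∀ a → a * ∧ a ≡ 𝟘
  *∧≡𝟘 a = pseudo-elim a (a *) ≤-refl

  ⋁L-map-closed : ∀ {A : Set} {P : Carrier → Set} → P 𝟘 → (∀ {x y} → P x → P y → P (x ∨ y))
                → (g : A → Carrier) → (∀ e → P (g e)) → ∀ u → P (⋁L (map g u))
  ⋁L-map-closed {P = P} P𝟘 P∨ g Pg u = foldr-preservesᵇ {P = P} P∨ P𝟘 (map⁺ (universal Pg u))

  ⋁L-map-least : ∀ {A : Set} {a} (g : A → Carrier) → (∀ e → g e ≤ a) → ∀ u → ⋁L (map g u) ≤ a
  ⋁L-map-least {a = a} = ⋁L-map-closed {P = _≤ a} (minimum a) ∨-least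

  ⋁L-++ : ∀ xs ys → ⋁L xs ∨ ⋁L ys ≤ ⋁L (xs ++ ys)
  ⋁L-++ []       ys = ∨-least (minimum _) ≤-refl
  ⋁L-++ (x ∷ xs) ys = begin
    (x ∨ ⋁L xs) ∨ ⋁L ys  ≡⟨ ∨-assoc x (⋁L xs) (⋁L ys) ⟩
    x ∨ (⋁L xs ∨ ⋁L ys)  ≤⟨ ∨-monotonic ≤-refl (⋁L-++ xs ys) ⟩
    x ∨ ⋁L (xs ++ ys)    ∎

  ∧-distribˡ-⋁L : ∀ {A : Set} (g : A → Carrier) b u
                → b ∧ ⋁L (map g u) ≤ ⋁L (map (λ e → b ∧ g e) u)
  ∧-distribˡ-⋁L g b []      = x∧y≤y b 𝟘
  ∧-distribˡ-⋁L g b (e ∷ u) = begin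
    b ∧ (g e ∨ ⋁L (map g u))    ≡⟨ ∧-distribˡ-∨ b (g e) _ ⟩
    b ∧ g e ∨ b ∧ ⋁L (map g u)  ≤⟨ ∨-monotonic ≤-refl (∧-distribˡ-⋁L g b u) ⟩
    b ∧ g e ∨ ⋁L (map (λ e → b ∧ g e) u)  ∎

  ≤⋁L⇒≤⋁L∧ : ∀ {A : Set} {x} (g : A → Carrier) u
           → x ≤ ⋁L (map g u) → x ≤ ⋁L (map (λ e → x ∧ g e) u)
  ≤⋁L⇒≤⋁L∧ g u x≤ = ≤-trans (∧-greatest ≤-refl x≤) (∧-distribˡ-⋁L g _ u)

module RoundIdealLocale (L : PCDLattice) (S : StrongInclusion L) where
  open PCDLattice L
  open StrongInclusion S
  open RoundIdeals L S
  open PCDLatticeProperties L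
  open ≤-Reasoning poset
  open IsRoundIdeal

  𝟘◁ : ∀ a → 𝟘 ◁ a
  𝟘◁ a = si-mono ≤-refl si-0 (minimum a)

  ≤𝟘⇒◁ : ∀ {x a} → x ≤ 𝟘 → x ◁ a
  ≤𝟘⇒◁ x≤𝟘 = si-mono x≤𝟘 (𝟘◁ _) ≤-refl

  ◁⇒≤ : ∀ {x y} → x ◁ y → x ≤ y
  ◁⇒≤ {x} {y} x◁y = begin
    x                ≤⟨ ∧-greatest ≤-refl (maximum x) ⟩
    x ∧ 𝟙            ≡⟨ cong (x ∧_) (sym (si-well x◁y)) ⟩
    x ∧ (x * ∨ y)    ≡⟨ ∧-distribˡ-∨ x (x *) y ⟩
    x ∧ x * ∨ x ∧ y  ≤⟨ ∨-least x∧x*≤y (x∧y≤y x y) ⟩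
    y                ∎
    where
      x∧x*≤y : x ∧ x * ≤ y
      x∧x*≤y = begin
        x ∧ x *  ≡⟨ ∧-comm x (x *) ⟩
        x * ∧ x  ≡⟨ *∧≡𝟘 x ⟩
        𝟘        ≤⟨ minimum y ⟩
        y        ∎

  ⋁L-map-◁ : ∀ {A : Set} (g h : A → Carrier) → (∀ e → g e ◁ h e)
           → ∀ u → ⋁L (map g u) ◁ ⋁L (map h u)
  ⋁L-map-◁ g h g◁h []      = si-0
  ⋁L-map-◁ g h g◁h (e ∷ u) =
    si-∨ (si-mono ≤-refl (g◁h e) (x≤x∨y _ _))
         (si-mono ≤-refl (⋁L-map-◁ g h g◁h u) (y≤x∨y _ _))

  Member : {J : Set} → (J → Subset) → Set
  Member {J} U = Σ J λ j → Σ Carrier (U j)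

  point : {J : Set} {U : J → Subset} → Member U → Carrier
  point (_ , y , _) = y

  ⊥ᵢ⇒≤𝟘 : ∀ {x} → ⊥ᵢ x → x ≤ 𝟘
  ⊥ᵢ⇒≤𝟘 ([] , x≤𝟘)           = x≤𝟘
  ⊥ᵢ⇒≤𝟘 (((() , _) ∷ _) , _)

  ideal-≤⋁L : ∀ {I A} → IsRoundIdeal I → (g : A → Carrier) → (∀ e → I (g e))
            → ∀ {x} u → x ≤ ⋁L (map g u) → I x
  ideal-≤⋁L {I} I-round g Ig u x≤ =
    down I-round x≤ (⋁L-map-closed {P = I} (has-𝟘 I-round) (∨-closed I-round) g Ig u)

  ⊤ᵢ-round : IsRoundIdeal ⊤ᵢ
  ⊤ᵢ-round = record
    { down     = λ _ _ → tt
    ; has-𝟘    = tt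
    ; ∨-closed = λ _ _ → tt
    ; round    = λ {b} _ → 𝟙 , tt , si-mono (maximum b) si-1 ≤-refl
    }

  ⇓-round : ∀ a → IsRoundIdeal (⇓ a)
  ⇓-round a = record
    { down     = λ x≤y y◁a → si-mono x≤y y◁a ≤-refl
    ; has-𝟘    = 𝟘◁ a
    ; ∨-closed = si-∨
    ; round    = λ b◁a → let (c , b◁c , c◁a) = si-interp b◁a in c , c◁a , b◁c
    }

  ∩-round : ∀ {A B} → IsRoundIdeal A → IsRoundIdeal B → IsRoundIdeal (A ∩ B)
  ∩-round A-round B-round = record
    { down     = λ x≤y (y∈A , y∈B) → down A-round x≤y y∈A , down B-round x≤y y∈B
    ; has-𝟘    = has-𝟘 A-round , has-𝟘 B-round
    ; ∨-closed = λ (x∈A , x∈B) (y∈A , y∈B) →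
                   ∨-closed A-round x∈A y∈A , ∨-closed B-round x∈B y∈B
    ; round    = λ (b∈A , b∈B) →
        let (a₁ , a₁∈A , b◁a₁) = round A-round b∈A
            (a₂ , a₂∈B , b◁a₂) = round B-round b∈B
        in a₁ ∧ a₂ , (down A-round (x∧y≤x a₁ a₂) a₁∈A , down B-round (x∧y≤y a₁ a₂) a₂∈B)
                   , si-∧ b◁a₁ b◁a₂
    }

  ⋁ᵢ-upper : ∀ {J : Set} (U : J → Subset) j → U j ⊆ ⋁ᵢ U
  ⋁ᵢ-upper U j x x∈Uj = ((j , x , x∈Uj) ∷ []) , x≤x∨y x 𝟘

  ⋁ᵢ-least : ∀ {J : Set} {U : J → Subset} {V} → IsRoundIdeal V → (∀ j → U j ⊆ V) → ⋁ᵢ U ⊆ V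
  ⋁ᵢ-least V-round U⊆V x (u , x≤) =
    ideal-≤⋁L V-round point (λ (j , y , y∈Uj) → U⊆V j y y∈Uj) u x≤

  ⋁ᵢ-∨-closed : ∀ {J : Set} {U : J → Subset} {x y} → ⋁ᵢ U x → ⋁ᵢ U y → ⋁ᵢ U (x ∨ y)
  ⋁ᵢ-∨-closed {x = x} {y} (u , x≤) (v , y≤) = u ++ v , (begin
    x ∨ y                                ≤⟨ ∨-monotonic x≤ y≤ ⟩
    ⋁L (map point u) ∨ ⋁L (map point v)  ≤⟨ ⋁L-++ (map point u) (map point v) ⟩
    ⋁L (map point u ++ map point v)      ≡⟨ cong ⋁L (map-++ point u v) ⟨
    ⋁L (map point (u ++ v))              ∎)

  ⋁ᵢ-round : ∀ {J : Set} (U : J → Subset) → (∀ j → IsRoundIdeal (U j)) → IsRoundIdeal (⋁ᵢ U)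
  ⋁ᵢ-round U U-round = record
    { down     = λ x≤y (u , y≤) → u , ≤-trans x≤y y≤
    ; has-𝟘    = [] , ≤-refl
    ; ∨-closed = ⋁ᵢ-∨-closed
    ; round    = λ (u , b≤) →
        ⋁L (map (point ∘ raise) u)
        , (map raise u , ≤-reflexive (cong ⋁L (map-∘ u)))
        , si-mono b≤ (⋁L-map-◁ point (point ∘ raise) point◁raise u) ≤-refl
    }
    where
      raise : Member U → Member U
      raise (j , y , y∈Uj) = let (a , a∈Uj , _) = round (U-round j) y∈Uj in j , a , a∈Uj

      point◁raise : ∀ e → point e ◁ point (raise e)
      point◁raise (j , y , y∈Uj) = proj₂ (proj₂ (round (U-round j) y∈Uj))

  ∩-distribˡ-⋁ᵢ : ∀ {J : Set} (A : Subset) (U : J → Subset) → IsRoundIdeal A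
                → (∀ j → IsRoundIdeal (U j))
                → (A ∩ ⋁ᵢ U) ≐ ⋁ᵢ (λ j → A ∩ U j)
  ∩-distribˡ-⋁ᵢ A U A-round U-round = to , from
    where
      to : A ∩ ⋁ᵢ U ⊆ ⋁ᵢ (λ j → A ∩ U j)
      to x (x∈A , u , x≤) =
        ideal-≤⋁L (⋁ᵢ-round _ (λ j → ∩-round A-round (U-round j)))
                  (λ e → x ∧ point e) meet∈ u (≤⋁L⇒≤⋁L∧ point u x≤)
        where
          meet∈ : ∀ e → ⋁ᵢ (λ j → A ∩ U j) (x ∧ point e)
          meet∈ (j , y , y∈Uj) =
            ⋁ᵢ-upper _ j (x ∧ y) (down A-round (x∧y≤x x y) x∈A , down (U-round j) (x∧y≤y x y) y∈Uj)

      from : ⋁ᵢ (λ j → A ∩ U j) ⊆ A ∩ ⋁ᵢ U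
      from = ⋁ᵢ-least (∩-round A-round (⋁ᵢ-round U U-round))
                      (λ j x (x∈A , x∈Uj) → x∈A , ⋁ᵢ-upper U j x x∈Uj)

  ⇓-basis : ∀ A → IsRoundIdeal A → A ≐ ⋁ᵢ {Σ Carrier λ a → ⇓ a ⊆ A} (λ e → ⇓ (proj₁ e))
  ⇓-basis A A-round = to , ⋁ᵢ-least A-round proj₂
    where
      to : A ⊆ ⋁ᵢ {Σ Carrier λ a → ⇓ a ⊆ A} (λ e → ⇓ (proj₁ e))
      to x x∈A =
        let (a , a∈A , x◁a) = round A-round x∈A
        in ⋁ᵢ-upper _ (a , λ y y◁a → down A-round (◁⇒≤ y◁a) a∈A) x x◁a

  isLocale : IsLocale
  isLocale = record
    { ⊤-round = ⊤ᵢ-round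
    ; ⇓-round = ⇓-round
    ; ∩-round = ∩-round
    ; ⋁-round = ⋁ᵢ-round
    ; ⋁-upper = λ U _ → ⋁ᵢ-upper U
    ; ⋁-least = λ _ _ _ V-round → ⋁ᵢ-least V-round
    ; distrib = ∩-distribˡ-⋁ᵢ
    ; basis   = ⇓-basis
    }

  𝟙∈⇒⊤ᵢ≐⋁ᵢ : ∀ {J : Set} {U : J → Subset} → ⋁ᵢ U 𝟙 → ⊤ᵢ ≐ ⋁ᵢ U
  𝟙∈⇒⊤ᵢ≐⋁ᵢ (u , 𝟙≤) = (λ x _ → u , ≤-trans (maximum x) 𝟙≤) , (λ _ _ → tt)

  ∨ᵢ-∨ : ∀ {A B x y} → A x → B y → (A ∨ᵢ B) (x ∨ y)
  ∨ᵢ-∨ {x = x} {y} x∈A y∈B =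
    ((true , x , x∈A) ∷ (false , y , y∈B) ∷ []) , ∨-monotonic ≤-refl (x≤x∨y y 𝟘)

  ⇓*∩⇓≐⊥ᵢ : ∀ b → (⇓ (b *) ∩ ⇓ b) ≐ ⊥ᵢ
  ⇓*∩⇓≐⊥ᵢ b = (λ y (y◁b* , y◁b) → [] , (begin
                  y        ≤⟨ ∧-greatest (◁⇒≤ y◁b*) (◁⇒≤ y◁b) ⟩
                  b * ∧ b  ≡⟨ *∧≡𝟘 b ⟩
                  𝟘        ∎))
            , (λ y y∈⊥ᵢ → ≤𝟘⇒◁ (⊥ᵢ⇒≤𝟘 y∈⊥ᵢ) , ≤𝟘⇒◁ (⊥ᵢ⇒≤𝟘 y∈⊥ᵢ))

  ◁⇒*∈⇓*ᵢ : ∀ {b c} → b ◁ c → (⇓ b *ᵢ) (c *)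
  ◁⇒*∈⇓*ᵢ {b} b◁c = ⋁ᵢ-upper _ (b * , ⇓*∩⇓≐⊥ᵢ b) _ (si-* b◁c)

  ∧-*ᵢ≤𝟘 : ∀ {B x t} → IsRoundIdeal B → B x → (B *ᵢ) t → x ∧ t ≤ 𝟘
  ∧-*ᵢ≤𝟘 {x = x} {t} B-round x∈B (u , t≤) = begin
    x ∧ t                             ≤⟨ ∧-monotonic ≤-refl t≤ ⟩
    x ∧ ⋁L (map point u)              ≤⟨ ∧-distribˡ-⋁L point x u ⟩
    ⋁L (map (λ e → x ∧ point e) u)    ≤⟨ ⋁L-map-least _ meet≤𝟘 u ⟩
    𝟘                                 ∎
    where
      meet≤𝟘 : ∀ e → x ∧ point e ≤ 𝟘
      meet≤𝟘 ((c , ⇓c∩B≐⊥ᵢ) , s , s◁c) =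
        ⊥ᵢ⇒≤𝟘 (proj₁ ⇓c∩B≐⊥ᵢ (x ∧ s) (si-mono (x∧y≤y x s) s◁c ≤-refl , down B-round (x∧y≤x x s) x∈B))

  ≺⇒⊆ : ∀ {A B} → IsRoundIdeal A → IsRoundIdeal B → B ≺ A → B ⊆ A
  ≺⇒⊆ {A} A-round B-round (⊤ᵢ⊆A∨B* , _) y y∈B =
    let (u , 𝟙≤) = ⊤ᵢ⊆A∨B* 𝟙 tt
    in ideal-≤⋁L A-round (λ e → y ∧ point e) meet∈A u
                 (≤⋁L⇒≤⋁L∧ point u (≤-trans (maximum y) 𝟙≤))
    where
      meet∈A : ∀ e → A (y ∧ point e)
      meet∈A (true  , t , t∈A)  = down A-round (x∧y≤y y t) t∈A
      meet∈A (false , t , t∈B*) = down A-round (∧-*ᵢ≤𝟘 B-round y∈B t∈B*) (has-𝟘 A-round)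

  ◁⇒⇓≺⇓ : ∀ {a b} → b ◁ a → ⇓ b ≺ ⇓ a
  ◁⇒⇓≺⇓ {a} {b} b◁a =
    let (b₁ , b◁b₁ , b₁◁a) = si-interp b◁a
        (b₂ , b₁◁b₂ , b₂◁a) = si-interp b₁◁a
    in 𝟙∈⇒⊤ᵢ≐⋁ᵢ (subst (⇓ a ∨ᵢ (⇓ b *ᵢ)) (trans (∨-comm b₂ (b₁ *)) (si-well b₁◁b₂))
                       (∨ᵢ-∨ b₂◁a (◁⇒*∈⇓*ᵢ b◁b₁)))

  isRegular : IsRegular
  isRegular a = to , ⋁ᵢ-least (⇓-round a) (λ (b , ⇓b≺⇓a) → ≺⇒⊆ (⇓-round a) (⇓-round b) ⇓b≺⇓a)
    where
      to : ⇓ a ⊆ ⋁ᵢ {Σ Carrier λ b → ⇓ b ≺ ⇓ a} (λ e → ⇓ (proj₁ e))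
      to x x◁a = let (b , x◁b , b◁a) = si-interp x◁a in ⋁ᵢ-upper _ (b , ◁⇒⇓≺⇓ b◁a) x x◁b

  module _ {J : Set} {U : J → Subset} where
    enumerate : (u : List (Member U)) → List (Member (λ i → U (lookup (map proj₁ u) i)))
    enumerate []                = []
    enumerate ((_ , y , y∈) ∷ u) = (zero , y , y∈) ∷ map (λ e → suc (proj₁ e) , proj₂ e) (enumerate u)

    map-point-enumerate : ∀ u → map point (enumerate u) ≡ map point u
    map-point-enumerate []              = refl
    map-point-enumerate ((_ , y , _) ∷ u) =
      cong (y ∷_) (trans (sym (map-∘ (enumerate u))) (map-point-enumerate u))

    ⋁ᵢ-finite : ∀ {x} → ⋁ᵢ U x → Σ (List J) λ js → ⋁ᵢ (λ i → U (lookup js i)) x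
    ⋁ᵢ-finite (u , x≤) =
      map proj₁ u , enumerate u , subst (_ ≤_) (cong ⋁L (sym (map-point-enumerate u))) x≤

  isCompact : IsCompact
  isCompact J f ⊤ᵢ≐⋁ᵢ =
    let (js , 𝟙∈) = ⋁ᵢ-finite (proj₁ ⊤ᵢ≐⋁ᵢ 𝟙 tt) in js , 𝟙∈⇒⊤ᵢ≐⋁ᵢ 𝟙∈

lemma4p2 : (L : PCDLattice) (S : StrongInclusion L) → RoundIdeals.IsCompactRegularLocale L S
lemma4p2 L S = isLocale , isRegular , isCompact
  where open RoundIdealLocale L S
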